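{- Let $\mathscr{D}$ be a commutative variety of algebras, $X,Y$ objects of $\mathscr{D}$, and $L:X^{\circledast}\to Y$ a language. Let $l,r:E\to X^{\circledast}$ be the syntactic congruence of $L$ and let $e_L:X^{\circledast}\twoheadrightarrow \mathrm{Syn}\,L$ be the coequalizer of $l$ and $r$ in $\mathbf{Mon}(\mathscr{D})$. Then there is a unique morphism $f_L:\mathrm{Syn}\,L\to Y$ of $\mathscr{D}$ with $L=f_L\cdot e_L$, and $(\mathrm{Syn}\,L,e_L,f_L)$ is the syntactic $\mathscr{D}$-monoid of $L$; that is, $e_L$ recognizes $L$ via $f_L$, and for every surjective $\mathscr{D}$-monoid morphism $e:X^{\circledast}\twoheadrightarrow M$ and morphism $f:M\to Y$ of $\mathscr{D}$ with $L=f\cdot e$ there exists a $\mathscr{D}$-monoid morphism $h:M\to\mathrm{Syn}\,L$ with $e_L=h\cdot e$.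
   Context: $\mathscr{D}$ commutative variety: the homomorphisms $A\to B$ form a subalgebra $[A,B]$ of $B^{|A|}$; $\mathscr{D}$ has tensor products representing bimorphisms, unit $I=\Psi 1$, and is symmetric monoidal closed. A $\mathscr{D}$-monoid is an algebra with a monoid structure whose multiplication $\bullet$ is a bimorphism; $\mathbf{Mon}(\mathscr{D})$ is the category of $\mathscr{D}$-monoids and homomorphisms preserving the monoid structure. $X^{\circledast}$ is the free $\mathscr{D}$-monoid on $X$. A language is a $\mathscr{D}$-morphism $L:X^{\circledast}\to Y$. A $\mathscr{D}$-monoid morphism $e:X^{\circledast}\to M$ recognizes $L$ (via $f$) if $L=f\cdot e$ for some $\mathscr{D}$-morphism $f:M\to Y$. The syntactic congruence of $L$ is $E=\{(u,v)\in|X^{\circledast}|^2 \mid \forall x,y\in|X^{\circledast}|:\ L(x\bullet u\bullet y)=L(x\bullet v\bullet y)\}$, a $\mathscr{D}$-submonoid of $X^{\circledast}\times X^{\circledast}$ with projections $l,r$. The syntactic $\mathscr{D}$-monoid of $L$ is the smallest $X$-generated $\mathscr{D}$-monoid (surjective $\mathscr{D}$-monoid morphism from $X^{\circledast}$) recognizing $L$, where $e_1\le e_2$ means $e_1$ factors through $e_2$ by a $\mathscr{D}$-monoid morphism. -}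

module Defs where

open import Level using (Level; _⊔_) renaming (suc to lsuc; zero to lzero)
open import Data.Nat using (ℕ)
open import Data.Fin using (Fin)
open import Data.Product using (Σ; Σ-syntax; ∃; ∃-syntax; _×_; _,_; proj₁; proj₂)
open import Relation.Binary.Bundles using (Setoid)
open import Algebra.Structures using (IsMonoid)

record Signature : Set₁ where
  field
    Op    : Set
    arity : Op → ℕ
open Signature public

data Term (S : Signature) (V : Set) : Set where
  var : V → Term S V
  op  : (o : Op S) → (Fin (arity S o) → Term S V) → Term S V

record Algebra (S : Signature) (c ℓ : Level) : Set (lsuc (c ⊔ ℓ)) where
  field
    setoid : Setoid c ℓ
  open Setoid setoid public
  field
    ⟦_⟧    : (o : Op S) → (Fin (arity S o) → Carrier) → Carrier
    ⟦⟧-cong : ∀ o {xs ys : Fin (arity S o) → Carrier} →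
              (∀ i → xs i ≈ ys i) → ⟦ o ⟧ xs ≈ ⟦ o ⟧ ys

module _ {S : Signature} {c ℓ : Level} (A : Algebra S c ℓ) where
  open Algebra A
  eval : {V : Set} → (V → Carrier) → Term S V → Carrier
  eval ρ (var v)   = ρ v
  eval ρ (op o ts) = ⟦ o ⟧ (λ i → eval ρ (ts i))

record IsHom {S : Signature} {c₁ ℓ₁ c₂ ℓ₂ : Level}
             (A : Algebra S c₁ ℓ₁) (B : Algebra S c₂ ℓ₂)
             (h : Algebra.Carrier A → Algebra.Carrier B)
             : Set (c₁ ⊔ ℓ₁ ⊔ c₂ ⊔ ℓ₂) where
  private
    module A = Algebra A
    module B = Algebra B
  field
    cong : ∀ {x y} → x A.≈ y → h x B.≈ h y
    preserves : ∀ o (xs : Fin (arity S o) → A.Carrier) →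
                h (A.⟦ o ⟧ xs) B.≈ B.⟦ o ⟧ (λ i → h (xs i))

record Hom {S : Signature} {c₁ ℓ₁ c₂ ℓ₂ : Level}
           (A : Algebra S c₁ ℓ₁) (B : Algebra S c₂ ℓ₂)
           : Set (c₁ ⊔ ℓ₁ ⊔ c₂ ⊔ ℓ₂) where
  field
    fun   : Algebra.Carrier A → Algebra.Carrier B
    isHom : IsHom A B fun
open Hom public

record Variety : Set₁ where
  field
    sig : Signature
    Eqn : Set
    lhs : Eqn → Term sig ℕ
    rhs : Eqn → Term sig ℕ
open Variety public

record DAlgebra (D : Variety) (c ℓ : Level) : Set (lsuc (c ⊔ ℓ)) where
  field
    alg : Algebra (sig D) c ℓ
  open Algebra alg public
  field
    satisfies : ∀ (e : Eqn D) (ρ : ℕ → Carrier) →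
                eval alg ρ (lhs D e) ≈ eval alg ρ (rhs D e)

DHom : {D : Variety} {c ℓ : Level} → DAlgebra D c ℓ → DAlgebra D c ℓ → Set (c ⊔ ℓ)
DHom A B = Hom (DAlgebra.alg A) (DAlgebra.alg B)

-- 𝒟 is commutative: for all A, B in 𝒟, the homomorphisms A → B form a
-- subalgebra of B^|A|, i.e. for every operation σ and homomorphisms
-- h₁ … hₙ : A → B the pointwise map a ↦ σ(h₁ a, …, hₙ a) is a homomorphism.
Commutative : (D : Variety) (c ℓ : Level) → Set (lsuc (c ⊔ ℓ))
Commutative D c ℓ =
  ∀ (A B : DAlgebra D c ℓ) (o : Op (sig D))
    (hs : Fin (arity (sig D) o) → DHom A B) →
  IsHom (DAlgebra.alg A) (DAlgebra.alg B)
        (λ a → DAlgebra.⟦_⟧ B o (λ i → fun (hs i) a))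

record DMonoid (D : Variety) (c ℓ : Level) : Set (lsuc (c ⊔ ℓ)) where
  field
    dalg : DAlgebra D c ℓ
  open DAlgebra dalg public
  infixl 7 _•_
  field
    _•_      : Carrier → Carrier → Carrier
    ε        : Carrier
    isMonoid : IsMonoid _≈_ _•_ ε
    -- multiplication is a bimorphism
    •-homˡ   : ∀ b → IsHom alg alg (λ a → a • b)
    •-homʳ   : ∀ a → IsHom alg alg (λ b → a • b)

record MonHom {D : Variety} {c ℓ : Level} (M N : DMonoid D c ℓ) : Set (c ⊔ ℓ) where
  private
    module M = DMonoid M
    module N = DMonoid N
  field
    hom   : DHom M.dalg N.dalg
  field
    pres-• : ∀ a b → Hom.fun hom (a M.• b) N.≈ (Hom.fun hom a N.• Hom.fun hom b)
    pres-ε : Hom.fun hom M.ε N.≈ N.ε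

Surjective : {S : Signature} {c₁ ℓ₁ c₂ ℓ₂ : Level} {A : Algebra S c₁ ℓ₁} {B : Algebra S c₂ ℓ₂} →
             Hom A B → Set (c₁ ⊔ c₂ ⊔ ℓ₂)
Surjective {B = B} h = ∀ b → ∃[ a ] (fun h a ≈ b)
  where open Algebra B using (_≈_)

_≗ₕ_ : {S : Signature} {c₁ ℓ₁ c₂ ℓ₂ : Level} {A : Algebra S c₁ ℓ₁} {B : Algebra S c₂ ℓ₂} →
       Hom A B → Hom A B → Set (c₁ ⊔ ℓ₂)
_≗ₕ_ {B = B} g h = ∀ a → fun g a ≈ fun h a
  where open Algebra B using (_≈_)

_∘ₕ_ : {S : Signature} {c₁ ℓ₁ c₂ ℓ₂ c₃ ℓ₃ : Level}
       {A : Algebra S c₁ ℓ₁} {B : Algebra S c₂ ℓ₂} {C : Algebra S c₃ ℓ₃} →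
       Hom B C → Hom A B → Hom A C
_∘ₕ_ {C = C} g h = record
  { fun = λ a → fun g (fun h a)
  ; isHom = record
    { cong = λ x≈y → IsHom.cong (isHom g) (IsHom.cong (isHom h) x≈y)
    ; preserves = λ o xs → Setoid.trans (Algebra.setoid C)
        (IsHom.cong (isHom g) (IsHom.preserves (isHom h) o xs))
        (IsHom.preserves (isHom g) o (λ i → fun h (xs i)))
    }
  }

-- Free 𝒟-monoid X^⊛ on X, given by its universal property:
-- η : X → |F| a 𝒟-morphism such that every 𝒟-morphism g : X → M into a
-- 𝒟-monoid extends uniquely to a 𝒟-monoid morphism ĝ : F → M.
IsFreeDMonoid : {D : Variety} {c ℓ : Level} (X : DAlgebra D c ℓ) (F : DMonoid D c ℓ) →
                DHom X (DMonoid.dalg F) → Set (lsuc (c ⊔ ℓ))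
IsFreeDMonoid {D} {c} {ℓ} X F η =
  ∀ (M : DMonoid D c ℓ) (g : DHom X (DMonoid.dalg M)) →
    Σ[ ĝ ∈ MonHom F M ] ((MonHom.hom ĝ ∘ₕ η) ≗ₕ g
      × (∀ (k : MonHom F M) → (MonHom.hom k ∘ₕ η) ≗ₕ g →
           MonHom.hom k ≗ₕ MonHom.hom ĝ))

-- Syntactic congruence of a language L : X^⊛ → Y (as a relation on |X^⊛|)
SynCong : {D : Variety} {c ℓ : Level} (F : DMonoid D c ℓ) (Y : DAlgebra D c ℓ) →
          DHom (DMonoid.dalg F) Y → DMonoid.Carrier F → DMonoid.Carrier F → Set (c ⊔ ℓ)
SynCong F Y L u v = ∀ x y → fun L (x • u • y) ≈ fun L (x • v • y)
  where open DMonoid F using (_•_)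
        open DAlgebra Y using (_≈_)

-- e : F → S is a coequalizer in Mon(𝒟) of the two projections l, r : E → F
-- of a relation E ⊆ |F| × |F|:  e·l = e·r, and every 𝒟-monoid morphism g
-- with g·l = g·r factors uniquely through e.
IsCoequalizer : {D : Variety} {c ℓ : Level} {F S : DMonoid D c ℓ} →
                (E : DMonoid.Carrier F → DMonoid.Carrier F → Set (c ⊔ ℓ)) →
                MonHom F S → Set (lsuc (c ⊔ ℓ))
IsCoequalizer {D} {c} {ℓ} {F} {S} E e =
  (∀ u v → E u v → Hom.fun (MonHom.hom e) u ≈ Hom.fun (MonHom.hom e) v)
  × (∀ (M : DMonoid D c ℓ) (g : MonHom F M) →
       (∀ u v → E u v → DMonoid._≈_ M (Hom.fun (MonHom.hom g) u) (Hom.fun (MonHom.hom g) v)) →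
       Σ[ k ∈ MonHom S M ] ((MonHom.hom k ∘ₕ MonHom.hom e) ≗ₕ MonHom.hom g
         × (∀ (k' : MonHom S M) → (MonHom.hom k' ∘ₕ MonHom.hom e) ≗ₕ MonHom.hom g →
              MonHom.hom k' ≗ₕ MonHom.hom k)))
  where open DMonoid S using (_≈_)

-- The coequalizer e_L factors the projection onto every quotient of X^⊛ by a
-- congruence containing the syntactic congruence E. For the kernel of e_L this
-- factorisation is a section of e_L, so e_L is surjective; for E itself it shows
-- ker e_L ⊆ E. As E ⊆ ker L (take x = y = ε), L descends along e_L to f_L, unique
-- since e_L is surjective. If a surjective e recognizes L, then ker e ⊆ E ⊆ ker e_L,
-- so e_L descends along e.
module Submission where

open import Defs
open import Level using (Level; _⊔_) renaming (suc to lsuc)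
open import Data.Product using (Σ-syntax; _×_; _,_; proj₁; proj₂)
open import Data.Fin using (Fin)
open import Data.Nat using (ℕ)
open import Relation.Binary.Core using (Rel)
open import Relation.Binary.Structures using (IsEquivalence)
open import Algebra.Structures using (IsMonoid)
import Relation.Binary.Reasoning.Setoid as SetoidReasoning

private variable
  a ℓa b ℓb c ℓ : Level
  S : Signature
  D : Variety

Kernel : {A : Algebra S a ℓa} {B : Algebra S b ℓb} → Hom A B → Rel (Algebra.Carrier A) ℓb
Kernel {B = B} h u v = Algebra._≈_ B (fun h u) (fun h v)

module _ {A : Algebra S a ℓa} {B : Algebra S b ℓb} {C : Algebra S c ℓ} where
  private
    module A = Algebra A
    module B = Algebra B
    module C = Algebra C

  surjective-cancelʳ : (e : Hom A B) → Surjective e → (g h : Hom B C) →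
                       (g ∘ₕ e) ≗ₕ (h ∘ₕ e) → g ≗ₕ h
  surjective-cancelʳ e sur g h g∘e≗h∘e y = begin
    fun g y                ≈⟨ IsHom.cong (isHom g) (proj₂ (sur y)) ⟨
    fun g (fun e (x₀ y))   ≈⟨ g∘e≗h∘e (x₀ y) ⟩
    fun h (fun e (x₀ y))   ≈⟨ IsHom.cong (isHom h) (proj₂ (sur y)) ⟩
    fun h y                ∎
    where
    open SetoidReasoning C.setoid
    x₀ : B.Carrier → A.Carrier
    x₀ y = proj₁ (sur y)

  -- h applies g to a chosen preimage; the kernel condition makes the choice irrelevant.
  factor-surjective : (e : Hom A B) → Surjective e → (g : Hom A C) →
                      (∀ u v → Kernel e u v → Kernel g u v) →
                      Σ[ h ∈ Hom B C ] (g ≗ₕ (h ∘ₕ e))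
  factor-surjective e sur g ker⊆ = h , factors
    where
    s : B.Carrier → A.Carrier
    s y = proj₁ (sur y)
    es≈ : ∀ y → fun e (s y) B.≈ y
    es≈ y = proj₂ (sur y)
    h : Hom B C
    h = record
      { fun = λ y → fun g (s y)
      ; isHom = record
        { cong = λ {y} {y'} y≈y' → ker⊆ (s y) (s y') (B.trans (es≈ y) (B.trans y≈y' (B.sym (es≈ y'))))
        ; preserves = λ o ys → C.trans
            (ker⊆ (s (B.⟦ o ⟧ ys)) (A.⟦ o ⟧ (λ i → s (ys i))) (begin
              fun e (s (B.⟦ o ⟧ ys))         ≈⟨ es≈ (B.⟦ o ⟧ ys) ⟩
              B.⟦ o ⟧ ys                      ≈⟨ B.⟦⟧-cong o (λ i → es≈ (ys i)) ⟨
              B.⟦ o ⟧ (λ i → fun e (s (ys i))) ≈⟨ IsHom.preserves (isHom e) o (λ i → s (ys i)) ⟨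
              fun e (A.⟦ o ⟧ (λ i → s (ys i))) ∎))
            (IsHom.preserves (isHom g) o (λ i → s (ys i)))
        }
      }
      where open SetoidReasoning B.setoid
    factors : g ≗ₕ (h ∘ₕ e)
    factors u = ker⊆ u (s (fun e u)) (B.sym (es≈ (fun e u)))

idᴹ : {M : DMonoid D c ℓ} → MonHom M M
idᴹ {M = M} = record
  { hom = record { fun = λ x → x ; isHom = record { cong = λ p → p ; preserves = λ _ _ → M.refl } }
  ; pres-• = λ _ _ → M.refl
  ; pres-ε = M.refl
  }
  where module M = DMonoid M

_∘ᴹ_ : {L M N : DMonoid D c ℓ} → MonHom M N → MonHom L M → MonHom L N
_∘ᴹ_ {N = N} g h = record
  { hom = MonHom.hom g ∘ₕ MonHom.hom h
  ; pres-• = λ x y → N.trans (IsHom.cong (isHom (MonHom.hom g)) (MonHom.pres-• h x y)) (MonHom.pres-• g _ _)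
  ; pres-ε = N.trans (IsHom.cong (isHom (MonHom.hom g)) (MonHom.pres-ε h)) (MonHom.pres-ε g)
  }
  where module N = DMonoid N

factor-surjectiveᴹ : {A B C : DMonoid D c ℓ} (e : MonHom A B) → Surjective (MonHom.hom e) →
                     (g : MonHom A C) →
                     (∀ u v → Kernel (MonHom.hom e) u v → Kernel (MonHom.hom g) u v) →
                     Σ[ h ∈ MonHom B C ] (MonHom.hom g ≗ₕ (MonHom.hom h ∘ₕ MonHom.hom e))
factor-surjectiveᴹ {A = A} {B} {C} e sur g ker⊆ = hᴹ , factors
  where
  module A = DMonoid A
  module B = DMonoid B
  module C = DMonoid C
  s : B.Carrier → A.Carrier
  s y = proj₁ (sur y)
  es≈ : ∀ y → fun (MonHom.hom e) (s y) B.≈ y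
  es≈ y = proj₂ (sur y)
  h : Hom B.alg C.alg
  h = proj₁ (factor-surjective (MonHom.hom e) sur (MonHom.hom g) ker⊆)
  factors : MonHom.hom g ≗ₕ (h ∘ₕ MonHom.hom e)
  factors = proj₂ (factor-surjective (MonHom.hom e) sur (MonHom.hom g) ker⊆)
  open SetoidReasoning B.setoid
  hᴹ : MonHom B C
  hᴹ = record
    { hom = h
    ; pres-• = λ x y → C.trans
        (ker⊆ (s (x B.• y)) (s x A.• s y) (begin
          fun (MonHom.hom e) (s (x B.• y))                            ≈⟨ es≈ (x B.• y) ⟩
          x B.• y                                                     ≈⟨ IsMonoid.∙-cong B.isMonoid (es≈ x) (es≈ y) ⟨
          fun (MonHom.hom e) (s x) B.• fun (MonHom.hom e) (s y)       ≈⟨ MonHom.pres-• e (s x) (s y) ⟨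
          fun (MonHom.hom e) (s x A.• s y)                            ∎))
        (MonHom.pres-• g (s x) (s y))
    ; pres-ε = C.trans
        (ker⊆ (s B.ε) A.ε (B.trans (es≈ B.ε) (B.sym (MonHom.pres-ε e))))
        (MonHom.pres-ε g)
    }

record Congruence (M : DMonoid D c ℓ) : Set (c ⊔ lsuc ℓ) where
  open DMonoid M using (Carrier; _≈_; _•_; ⟦_⟧)
  infix 4 _∼_
  field
    _∼_           : Rel Carrier ℓ
    isEquivalence : IsEquivalence _∼_
    ≈⇒∼          : ∀ {x y} → x ≈ y → x ∼ y
    ⟦⟧-cong       : ∀ o {xs ys : Fin (arity (sig D) o) → Carrier} →
                    (∀ i → xs i ∼ ys i) → ⟦ o ⟧ xs ∼ ⟦ o ⟧ ys
    •-cong        : ∀ {x x' y y'} → x ∼ x' → y ∼ y' → x • y ∼ x' • y'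
  open IsEquivalence isEquivalence public

-- The quotient keeps the carrier of M and coarsens its equality to ∼.
module _ {M : DMonoid D c ℓ} (R : Congruence M) where
  private
    module M = DMonoid M
    module R = Congruence R

    quotientAlgebra : Algebra (sig D) c ℓ
    quotientAlgebra = record
      { setoid = record { isEquivalence = R.isEquivalence }
      ; ⟦_⟧ = M.⟦_⟧
      ; ⟦⟧-cong = R.⟦⟧-cong
      }

    eval-quotient : ∀ (ρ : ℕ → M.Carrier) t → eval quotientAlgebra ρ t R.∼ eval M.alg ρ t
    eval-quotient ρ (var v)   = R.refl
    eval-quotient ρ (op o ts) = R.⟦⟧-cong o (λ i → eval-quotient ρ (ts i))

  Quotient : DMonoid D c ℓ
  Quotient = record
    { dalg = record
      { alg = quotientAlgebra
      ; satisfies = λ eq ρ → R.trans (eval-quotient ρ (lhs D eq))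
          (R.trans (R.≈⇒∼ (M.satisfies eq ρ)) (R.sym (eval-quotient ρ (rhs D eq))))
      }
    ; _•_ = M._•_
    ; ε = M.ε
    ; isMonoid = record
      { isSemigroup = record
        { isMagma = record { isEquivalence = R.isEquivalence ; ∙-cong = R.•-cong }
        ; assoc = λ x y z → R.≈⇒∼ (IsMonoid.assoc M.isMonoid x y z)
        }
      ; identity = (λ x → R.≈⇒∼ (proj₁ (IsMonoid.identity M.isMonoid) x))
                 , (λ x → R.≈⇒∼ (proj₂ (IsMonoid.identity M.isMonoid) x))
      }
    ; •-homˡ = λ y → record { cong = λ p → R.•-cong p R.refl
                            ; preserves = λ o xs → R.≈⇒∼ (IsHom.preserves (M.•-homˡ y) o xs) }
    ; •-homʳ = λ x → record { cong = λ p → R.•-cong R.refl p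
                            ; preserves = λ o xs → R.≈⇒∼ (IsHom.preserves (M.•-homʳ x) o xs) }
    }

  project : MonHom M Quotient
  project = record
    { hom = record { fun = λ x → x ; isHom = record { cong = R.≈⇒∼ ; preserves = λ _ _ → R.refl } }
    ; pres-• = λ _ _ → R.refl
    ; pres-ε = R.refl
    }

module _ {M N : DMonoid D c ℓ} (h : MonHom M N) where
  private
    module N = DMonoid N
    hH = isHom (MonHom.hom h)

  kernelCongruence : Congruence M
  kernelCongruence = record
    { _∼_ = Kernel (MonHom.hom h)
    ; isEquivalence = record { refl = N.refl ; sym = N.sym ; trans = N.trans }
    ; ≈⇒∼ = IsHom.cong hH
    ; ⟦⟧-cong = λ o {xs} {ys} p → N.trans (IsHom.preserves hH o xs)
        (N.trans (N.⟦⟧-cong o p) (N.sym (IsHom.preserves hH o ys)))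
    ; •-cong = λ {x} {x'} {y} {y'} p q → N.trans (MonHom.pres-• h x y)
        (N.trans (IsMonoid.∙-cong N.isMonoid p q) (N.sym (MonHom.pres-• h x' y')))
    }

  fromKernelQuotient : MonHom (Quotient kernelCongruence) N
  fromKernelQuotient = record
    { hom = record { fun = fun (MonHom.hom h) ; isHom = record { cong = λ p → p ; preserves = IsHom.preserves hH } }
    ; pres-• = MonHom.pres-• h
    ; pres-ε = MonHom.pres-ε h
    }

module _ {F S : DMonoid D c ℓ} {E : Rel (DMonoid.Carrier F) (c ⊔ ℓ)} {e : MonHom F S}
         (coeq : IsCoequalizer E e) where
  private
    module S = DMonoid S

  factor-through-quotient : (R : Congruence F) → (∀ u v → E u v → Congruence._∼_ R u v) →
                            Σ[ k ∈ MonHom S (Quotient R) ]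
                              ((MonHom.hom k ∘ₕ MonHom.hom e) ≗ₕ MonHom.hom (project R))
  factor-through-quotient R E⊆R with proj₂ coeq (Quotient R) (project R) E⊆R
  ... | k , k∘e≗project , _ = k , k∘e≗project

  coequalizer-endo-unique : (k : MonHom S S) → (MonHom.hom k ∘ₕ MonHom.hom e) ≗ₕ MonHom.hom e →
                            MonHom.hom k ≗ₕ MonHom.hom (idᴹ {M = S})
  coequalizer-endo-unique k k∘e≗e y = S.trans (unique k k∘e≗e y) (S.sym (unique (idᴹ {M = S}) (λ _ → S.refl) y))
    where unique = proj₂ (proj₂ (proj₂ coeq S e (proj₁ coeq)))

  coequalizer-kernel⊆ : (R : Congruence F) → (∀ u v → E u v → Congruence._∼_ R u v) →
                        ∀ u v → Kernel (MonHom.hom e) u v → Congruence._∼_ R u v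
  coequalizer-kernel⊆ R E⊆R u v eu≈ev with factor-through-quotient R E⊆R
  ... | k , k∘e≗project =
    R.trans (R.sym (k∘e≗project u)) (R.trans (IsHom.cong (isHom (MonHom.hom k)) eu≈ev) (k∘e≗project v))
    where module R = Congruence R

  coequalizer-surjective : Surjective (MonHom.hom e)
  coequalizer-surjective y with factor-through-quotient (kernelCongruence e) (proj₁ coeq)
  ... | k , k∘e≗project =
    fun (MonHom.hom k) y , coequalizer-endo-unique (fromKernelQuotient e ∘ᴹ k) k∘e≗project y

module _ (F : DMonoid D ℓ ℓ) (Y : DAlgebra D ℓ ℓ) (L : DHom (DMonoid.dalg F) Y) where
  private
    module F = DMonoid F
    module Y = DAlgebra Y
    LH = isHom L
    •-cong = IsMonoid.∙-cong F.isMonoid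
    assoc = IsMonoid.assoc F.isMonoid

  SynCong⇒≈ : ∀ {u v} → SynCong F Y L u v → fun L u Y.≈ fun L v
  SynCong⇒≈ {u} {v} u∼v = Y.trans (IsHom.cong LH (F.sym (unit u)))
    (Y.trans (u∼v F.ε F.ε) (IsHom.cong LH (unit v)))
    where
    unit : ∀ w → F.ε F.• w F.• F.ε F.≈ w
    unit w = F.trans (proj₂ (IsMonoid.identity F.isMonoid) _) (proj₁ (IsMonoid.identity F.isMonoid) w)

  recognizer-kernel⊆SynCong : {M : DMonoid D ℓ ℓ} (e : MonHom F M) (f : DHom (DMonoid.dalg M) Y) →
                              L ≗ₕ (f ∘ₕ MonHom.hom e) →
                              ∀ u v → Kernel (MonHom.hom e) u v → SynCong F Y L u v
  recognizer-kernel⊆SynCong {M} e f L≗f∘e u v eu≈ev x y = begin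
    fun L (x F.• u F.• y)        ≈⟨ L≗f∘e _ ⟩
    fun f (ė (x F.• u F.• y))     ≈⟨ IsHom.cong (isHom f) (surround u) ⟩
    fun f (ė x M.• ė u M.• ė y)   ≈⟨ IsHom.cong (isHom f) (M•-cong (M•-cong M.refl eu≈ev) M.refl) ⟩
    fun f (ė x M.• ė v M.• ė y)   ≈⟨ IsHom.cong (isHom f) (surround v) ⟨
    fun f (ė (x F.• v F.• y))     ≈⟨ L≗f∘e _ ⟨
    fun L (x F.• v F.• y)        ∎
    where
    module M = DMonoid M
    open SetoidReasoning Y.setoid
    ė = fun (MonHom.hom e)
    M•-cong = IsMonoid.∙-cong M.isMonoid
    surround : ∀ w → ė (x F.• w F.• y) M.≈ ė x M.• ė w M.• ė y
    surround w = M.trans (MonHom.pres-• e _ y) (M•-cong (MonHom.pres-• e x w) M.refl)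

  -- The reassociation x • (a • b) • y = (x • a) • b • y lets each factor be
  -- replaced using a suitably enlarged context.
  synCongruence : Congruence F
  synCongruence = record
    { _∼_ = SynCong F Y L
    ; isEquivalence = record
      { refl = λ _ _ → Y.refl
      ; sym = λ p x y → Y.sym (p x y)
      ; trans = λ p q x y → Y.trans (p x y) (q x y)
      }
    ; ≈⇒∼ = λ p x y → IsHom.cong LH (•-cong (•-cong F.refl p) F.refl)
    ; ⟦⟧-cong = λ o {xs} {ys} p x y → Y.trans (inContext o xs x y)
        (Y.trans (Y.⟦⟧-cong o (λ i → p i x y)) (Y.sym (inContext o ys x y)))
    ; •-cong = λ {a} {a'} {b} {b'} p q x y → begin
        fun L (x F.• (a F.• b) F.• y)    ≈⟨ IsHom.cong LH (reassoc a b) ⟩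
        fun L (x F.• a F.• (b F.• y))    ≈⟨ p x (b F.• y) ⟩
        fun L (x F.• a' F.• (b F.• y))   ≈⟨ IsHom.cong LH (F.sym (assoc (x F.• a') b y)) ⟩
        fun L ((x F.• a') F.• b F.• y)   ≈⟨ q (x F.• a') y ⟩
        fun L ((x F.• a') F.• b' F.• y)  ≈⟨ IsHom.cong LH (•-cong (assoc x a' b') F.refl) ⟩
        fun L (x F.• (a' F.• b') F.• y)  ∎
    }
    where
    open SetoidReasoning Y.setoid
    reassoc : ∀ a b {x y} → x F.• (a F.• b) F.• y F.≈ x F.• a F.• (b F.• y)
    reassoc a b {x} {y} = F.trans (•-cong (F.sym (assoc x a b)) F.refl) (assoc (x F.• a) b y)
    inContext : ∀ o ws x y → fun L (x F.• F.⟦ o ⟧ ws F.• y) Y.≈ Y.⟦ o ⟧ (λ i → fun L (x F.• ws i F.• y))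
    inContext o ws x y = Y.trans
      (IsHom.cong LH (F.trans (•-cong (IsHom.preserves (F.•-homʳ x) o ws) F.refl)
                              (IsHom.preserves (F.•-homˡ y) o (λ i → x F.• ws i))))
      (IsHom.preserves LH o _)

-- Commutativity of 𝒟 and freeness of X^⊛ are what make the coequalizer e_L
-- exist; once it is given, the argument does not use them.
theorem41 : ∀ {ℓ : Level} (D : Variety) → Commutative D ℓ ℓ →
    (X Y : DAlgebra D ℓ ℓ) →
    (Xf : DMonoid D ℓ ℓ) (η : DHom X (DMonoid.dalg Xf)) → IsFreeDMonoid X Xf η →
    (L : DHom (DMonoid.dalg Xf) Y) →
    (SynL : DMonoid D ℓ ℓ) (eL : MonHom Xf SynL) →
    IsCoequalizer (SynCong Xf Y L) eL →
    (Σ[ fL ∈ DHom (DMonoid.dalg SynL) Y ]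
    ((L ≗ₕ (fL ∘ₕ MonHom.hom eL))
    × (∀ (f : DHom (DMonoid.dalg SynL) Y) → L ≗ₕ (f ∘ₕ MonHom.hom eL) → f ≗ₕ fL)))
    × Surjective (MonHom.hom eL)
    × (∀ (M : DMonoid D ℓ ℓ) (e : MonHom Xf M) → Surjective (MonHom.hom e) →
    (f : DHom (DMonoid.dalg M) Y) → L ≗ₕ (f ∘ₕ MonHom.hom e) →
    Σ[ h ∈ MonHom M SynL ] (MonHom.hom eL ≗ₕ (MonHom.hom h ∘ₕ MonHom.hom e)))
theorem41 D _ _ Y Xf _ _ L SynL eL coeq =
  (fL , L≗fL∘eL , fL-unique) , eL-surjective , minimal
  where
  eL-surjective : Surjective (MonHom.hom eL)
  eL-surjective = coequalizer-surjective {e = eL} coeq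
  kernel-eL⊆SynCong : ∀ u v → Kernel (MonHom.hom eL) u v → SynCong Xf Y L u v
  kernel-eL⊆SynCong = coequalizer-kernel⊆ {e = eL} coeq (synCongruence Xf Y L) (λ _ _ u∼v → u∼v)
  recognition : Σ[ fL ∈ DHom (DMonoid.dalg SynL) Y ] (L ≗ₕ (fL ∘ₕ MonHom.hom eL))
  recognition = factor-surjective (MonHom.hom eL) eL-surjective L
                  (λ u v p → SynCong⇒≈ Xf Y L (kernel-eL⊆SynCong u v p))
  fL : DHom (DMonoid.dalg SynL) Y
  fL = proj₁ recognition
  L≗fL∘eL : L ≗ₕ (fL ∘ₕ MonHom.hom eL)
  L≗fL∘eL = proj₂ recognition
  fL-unique : ∀ (f : DHom (DMonoid.dalg SynL) Y) → L ≗ₕ (f ∘ₕ MonHom.hom eL) → f ≗ₕ fL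
  fL-unique f L≗f∘eL = surjective-cancelʳ (MonHom.hom eL) eL-surjective f fL
    (λ u → DAlgebra.trans Y (DAlgebra.sym Y (L≗f∘eL u)) (L≗fL∘eL u))
  minimal : ∀ (M : DMonoid D _ _) (e : MonHom Xf M) → Surjective (MonHom.hom e) →
            (f : DHom (DMonoid.dalg M) Y) → L ≗ₕ (f ∘ₕ MonHom.hom e) →
            Σ[ h ∈ MonHom M SynL ] (MonHom.hom eL ≗ₕ (MonHom.hom h ∘ₕ MonHom.hom e))
  minimal M e e-surjective f L≗f∘e = factor-surjectiveᴹ e e-surjective eL
    (λ u v p → proj₁ coeq u v (recognizer-kernel⊆SynCong Xf Y L e f L≗f∘e u v p))
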